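{- Let $D\ge 2$ and let $H$ be an unweighted $k$-colorable strongly canonical clump graph with layers $L_0,\ldots,L_D$. Set $L_{ -1}=L_{D+1}=\emptyset$, and for $0\le i\le D$ let $S_i=\{x\in L_i : L_{i-1}\cup L_{i+1}\subseteq N(x)\}$, with $S_{ -1}=S_{D+1}=\emptyset$. Call $L_i$ big if $|S_i|>\frac{k}{2}$ and small otherwise. Then for each $i$ with $0\le i\le D$: (i) $|L_i|\le k-\max(|S_{i-1}|,|S_{i+1}|)$; (ii) $|S_i|\le k-1$; (iii) if $L_i$ is big, then $1\le i\le D-1$ and $L_{i-1},L_{i+1}$ are small; (iv) if $|L_i|=1$, then $L_i=S_i$; (v) $\max(|L_i\setminus S_i|,|L_{i+1}\setminus S_{i+1}|)\le k-|S_i|-|S_{i+1}|$; (vi) if $|S_i|=k-1$, then $L_i=S_i$ and for $j=i\pm 1$, $|L_j|=|S_j|=1$; (vii) if $k\in\{3,4\}$ and $L_i$ is big, then $|S_i|=k-1$.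
   Context: $N(x)$ denotes the set of neighbors of a vertex $x$ in $H$. Fix $k\ge 3$. A graph $G$ is $k$-colored if a fixed proper coloring of its vertices with colors from $\{1,\ldots,k\}$ is given. A connected graph $G$ is layered if a vertex $x$ whose eccentricity equals $D=\operatorname{diam}(G)$ is fixed, together with the layers $L_0=\{x\},\ldots,L_D$, where $L_i$ is the set of vertices at distance $i$ from $x$. Let $c(i)$ be the number of colors used on $L_i$. $G$ is saturated if any two differently colored vertices lying in the same layer, or in two consecutive layers, are adjacent. Such a $G$ is canonical if for every $0\le i\le D-1$: (a) if $c(i)=1$ then $c(i+1)\le k-1$; (b) the number of colors used on $L_i\cup L_{i+1}$ is $\min(k,c(i)+c(i+1))$; (c) if $c(i)=k$ then $i\ge 2$ and $c(i+1)\ge 2$; (d) if $L_i$ contains two vertices of the same color, then $i>0$ and $c(i)+\max(c(i-1),c(i+1))\ge k$. A clump of $G$ is a nonempty set of all vertices of some layer $L_i$ having a given color. The clump graph $H=H(G)$ has the clumps as vertices, two clumps adjacent iff some edge of $G$ joins them; $H$ inherits the coloring and the layering (layer $L_i$ of $H$ consists of the clumps in layer $L_i$ of $G$, so $|L_i|=c(i)$). An unweighted $k$-colorable strongly canonical clump graph is $H=H(G)$ with $D\ge 2$ and $G$ a saturated, $k$-colored, layered, connected, canonical graph with $c(0)=c(D)=1$. -}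

module Defs where

open import Data.Nat using (ℕ; zero; suc; _+_; _*_; _∸_; _≤_; _<_; _⊔_; _⊓_; _≡ᵇ_)
open import Data.Bool using (Bool; true; false; _∧_; _∨_; not; if_then_else_)
open import Data.Fin using (Fin; _≟_)
open import Data.List using (List; []; _∷_; allFin)
open import Data.Bool.ListAction using (any; all)
open import Data.Product using (_×_; ∃-syntax)
open import Data.Sum using (_⊎_)
open import Relation.Nullary using (does; ¬_)
open import Relation.Binary.PropositionalEquality using (_≡_; _≢_)

countB : {A : Set} → (A → Bool) → List A → ℕ
countB p [] = 0
countB p (a ∷ as) = if p a then suc (countB p as) else countB p as

_⇒ᵇ_ : Bool → Bool → Bool
a ⇒ᵇ b = not a ∨ b

_==ᶠ_ : {k : ℕ} → Fin k → Fin k → Bool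
a ==ᶠ b = does (a ≟ b)

data Walk {n : ℕ} (adj : Fin n → Fin n → Bool) : Fin n → Fin n → ℕ → Set where
  nil  : ∀ {u} → Walk adj u u 0
  cons : ∀ {u w v m} → adj u w ≡ true → Walk adj w v m → Walk adj u v (suc m)

IsDist : {n : ℕ} → (Fin n → Fin n → Bool) → Fin n → Fin n → ℕ → Set
IsDist adj u v d = Walk adj u v d × (∀ m → Walk adj u v m → d ≤ m)

record ColLayGraph (k : ℕ) : Set where
  field
    n      : ℕ
    adj    : Fin n → Fin n → Bool
    col    : Fin n → Fin k
    x      : Fin n
    D      : ℕ
    layer  : Fin n → ℕ

module _ {k : ℕ} (G : ColLayGraph k) where
  open ColLayGraph G

  clumpIn : ℕ → Fin k → Bool
  clumpIn i c = any (λ v → (layer v ≡ᵇ i) ∧ (col v ==ᶠ c)) (allFin n)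

  clumpAdj : ℕ → Fin k → ℕ → Fin k → Bool
  clumpAdj i c j c' =
    any (λ u → any (λ v → ((layer u ≡ᵇ i) ∧ (col u ==ᶠ c))
                          ∧ ((layer v ≡ᵇ j) ∧ (col v ==ᶠ c')) ∧ adj u v)
                   (allFin n))
        (allFin n)

  -- c(i) = number of colors used on L_i  = |L_i| in the clump graph H
  cnt : ℕ → ℕ
  cnt i = countB (clumpIn i) (allFin k)

  cnt2 : ℕ → ℕ
  cnt2 i = countB (λ c → clumpIn i c ∨ clumpIn (suc i) c) (allFin k)

  cntPrev : ℕ → ℕ
  cntPrev zero = 0
  cntPrev (suc i) = cnt i

  adjAllNbrLayers : ℕ → Fin k → Bool
  adjAllNbrLayers i c =
    all (λ c' → clumpIn (suc i) c' ⇒ᵇ clumpAdj i c (suc i) c') (allFin k)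
    ∧ prev i
    where
    prev : ℕ → Bool
    prev zero = true
    prev (suc j) = all (λ c' → clumpIn j c' ⇒ᵇ clumpAdj i c j c') (allFin k)

  inS : ℕ → Fin k → Bool
  inS i c = clumpIn i c ∧ adjAllNbrLayers i c

  sizeS : ℕ → ℕ
  sizeS i = countB (inS i) (allFin k)

  sizeSPrev : ℕ → ℕ
  sizeSPrev zero = 0
  sizeSPrev (suc i) = sizeS i

  sizeLminusS : ℕ → ℕ
  sizeLminusS i = countB (λ c → clumpIn i c ∧ not (inS i c)) (allFin k)

  LeqS : ℕ → Set
  LeqS i = ∀ c → clumpIn i c ≡ inS i c

  Big : ℕ → Set
  Big i = k < 2 * sizeS i

  Small : ℕ → Set
  Small i = 2 * sizeS i ≤ k

  SmallPrev : ℕ → Set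
  SmallPrev i = 2 * sizeSPrev i ≤ k

  record CanonicalAt (i : ℕ) : Set where
    field
      condA : cnt i ≡ 1 → cnt (suc i) ≤ k ∸ 1
      condB : cnt2 i ≡ k ⊓ (cnt i + cnt (suc i))
      condC : cnt i ≡ k → (2 ≤ i × 2 ≤ cnt (suc i))
      condD : (∃[ u ] ∃[ v ] (u ≢ v × layer u ≡ i × layer v ≡ i × col u ≡ col v))
              → (0 < i × k ≤ cnt i + (cnt (i ∸ 1) ⊔ cnt (suc i)))

  -- G is a simple, properly k-colored, layered (from x, with D = ecc(x) = diam G),
  -- connected, saturated, canonical graph with c(0) = c(D) = 1 and D ≥ 2;
  -- its clump graph H(G) is then an unweighted k-colorable strongly canonical clump graph.
  record StronglyCanonical : Set where
    field
      adj-sym     : ∀ u v → adj u v ≡ adj v u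
      adj-irrefl  : ∀ u → adj u u ≡ false
      proper      : ∀ u v → adj u v ≡ true → col u ≢ col v
      layer-dist  : ∀ v → IsDist adj x v (layer v)
      diam-bound  : ∀ u v → ∃[ d ] (d ≤ D × IsDist adj u v d)
      ecc-x       : ∃[ v ] (layer v ≡ D)
      saturated   : ∀ u v → col u ≢ col v
                    → (layer u ≡ layer v ⊎ suc (layer u) ≡ layer v ⊎ suc (layer v) ≡ layer u)
                    → adj u v ≡ true
      canonical   : ∀ i → i < D → CanonicalAt i
      D≥2         : 2 ≤ D
      c0          : cnt 0 ≡ 1
      cD          : cnt D ≡ 1

-- A clump of S_i is adjacent to every clump of L_{i-1} ∪ L_{i+1}, so by properness its colour
-- occurs in neither neighbouring layer; conversely, by saturation, a clump whose colour occurs in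
-- neither neighbouring layer lies in S_i. Thus S_i shares no colour with L_{i±1}; as every layer
-- is nonempty and L_0, L_D are single clumps, counting colours gives (i), (ii), (iii), (v) and
-- (vii). Canonicity (b) says that L_i and L_{i+1} share no colour as soon as c(i) + c(i+1) ≤ k;
-- with (a) and (c) this holds on both sides of a layer with a single clump, which therefore
-- equals its S (iv). If |S_i| = k - 1, the neighbouring layers have at most one colour each,
-- and (c) then forbids c(i) = k, forcing L_i = S_i (vi).
module Submission where

open import Defs
open import Data.Nat using (ℕ; zero; suc; _+_; _*_; _∸_; _≤_; _<_; _⊔_; _≡ᵇ_; z≤n; s≤s; _≤?_)
open import Data.Nat.Properties hiding (_≟_)
open import Data.Bool using (Bool; true; false; _∧_; _∨_; not)
open import Data.Bool.Properties using (T-≡)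
open import Data.Bool.ListAction using (any; all)
open import Data.Fin using (Fin; _≟_)
open import Data.List using (List; []; _∷_; allFin; length)
open import Data.List.Properties using (length-tabulate)
open import Data.List.Membership.Propositional using (_∈_; lose)
open import Data.List.Membership.Propositional.Properties using (∈-allFin)
open import Data.List.Relation.Unary.Any using (here; there; satisfied)
import Data.List.Relation.Unary.All as All
open import Data.List.Relation.Unary.Any.Properties using (any⁺; any⁻)
open import Data.List.Relation.Unary.All.Properties using (all⁺; all⁻)
open import Data.Product using (_×_; _,_; ∃-syntax; proj₁; proj₂; map₂)
open import Data.Sum using (_⊎_; inj₁; inj₂)
open import Data.Empty using (⊥-elim)
open import Function.Base using (_∘_; id)
open import Function.Bundles using (Equivalence)
open import Relation.Nullary using (¬_; yes; no)
open import Relation.Binary.PropositionalEquality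

∧-true⁻ : ∀ a {b} → a ∧ b ≡ true → a ≡ true × b ≡ true
∧-true⁻ true refl = refl , refl

∧-true⁺ : ∀ {a b} → a ≡ true → b ≡ true → a ∧ b ≡ true
∧-true⁺ refl refl = refl

⇒ᵇ-true⁻ : ∀ {a b} → a ⇒ᵇ b ≡ true → a ≡ true → b ≡ true
⇒ᵇ-true⁻ b≡true refl = b≡true

⇒ᵇ-true⁺ : ∀ {a b} → (a ≡ true → b ≡ true) → a ⇒ᵇ b ≡ true
⇒ᵇ-true⁺ {false} _ = refl
⇒ᵇ-true⁺ {true}  f = f refl

true⇔true⇒≡ : ∀ {a b} → (a ≡ true → b ≡ true) → (b ≡ true → a ≡ true) → a ≡ b
true⇔true⇒≡ {false} {false} _ _ = refl
true⇔true⇒≡ {false} {true}  _ g = g refl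
true⇔true⇒≡ {true}  f _ = sym (f refl)

==ᶠ⇒≡ : ∀ {n} {a b : Fin n} → (a ==ᶠ b) ≡ true → a ≡ b
==ᶠ⇒≡ {a = a} {b} e with a ≟ b
... | yes a≡b = a≡b
... | no  _   with () ← e

==ᶠ-refl : ∀ {n} (a : Fin n) → (a ==ᶠ a) ≡ true
==ᶠ-refl a with a ≟ a
... | yes _   = refl
... | no a≢a = ⊥-elim (a≢a refl)

≡ᵇ-refl : ∀ m → (m ≡ᵇ m) ≡ true
≡ᵇ-refl m = Equivalence.to T-≡ (≡⇒≡ᵇ m m refl)

module _ {A : Set} where

  any-true⁻ : (p : A → Bool) (xs : List A) → any p xs ≡ true → ∃[ x ] p x ≡ true
  any-true⁻ p xs e = map₂ (Equivalence.to T-≡) (satisfied (any⁻ p xs (Equivalence.from T-≡ e)))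

  any-true⁺ : (p : A → Bool) {x : A} {xs : List A} → x ∈ xs → p x ≡ true → any p xs ≡ true
  any-true⁺ p x∈xs px = Equivalence.to T-≡ (any⁺ p (lose x∈xs (Equivalence.from T-≡ px)))

  all-true⁻ : (p : A → Bool) {x : A} {xs : List A} → all p xs ≡ true → x ∈ xs → p x ≡ true
  all-true⁻ p {xs = xs} e x∈xs =
    Equivalence.to T-≡ (All.lookup (all⁺ p xs (Equivalence.from T-≡ e)) x∈xs)

  all-true⁺ : (p : A → Bool) {xs : List A} → (∀ x → p x ≡ true) → all p xs ≡ true
  all-true⁺ p {xs} px =
    Equivalence.to T-≡ (all⁻ p {xs} (All.tabulate λ {x} _ → Equivalence.from T-≡ (px x)))

  countB≤length : (p : A → Bool) (xs : List A) → countB p xs ≤ length xs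
  countB≤length p [] = z≤n
  countB≤length p (x ∷ xs) with p x
  ... | true  = s≤s (countB≤length p xs)
  ... | false = m≤n⇒m≤1+n (countB≤length p xs)

  countB-mono : {p q : A → Bool} → (∀ x → p x ≡ true → q x ≡ true) →
                (xs : List A) → countB p xs ≤ countB q xs
  countB-mono p⇒q [] = z≤n
  countB-mono {p} {q} p⇒q (x ∷ xs) with p x | q x | p⇒q x
  ... | true  | true  | _  = s≤s (countB-mono p⇒q xs)
  ... | true  | false | px with () ← px refl
  ... | false | true  | _  = m≤n⇒m≤1+n (countB-mono p⇒q xs)
  ... | false | false | _  = countB-mono p⇒q xs

  countB-disjoint : {p q : A → Bool} → (∀ x → p x ≡ true → q x ≢ true) →
                    (xs : List A) → countB p xs + countB q xs ≤ length xs
  countB-disjoint p#q [] = z≤n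
  countB-disjoint {p} {q} p#q (x ∷ xs) with p x | q x | p#q x
  ... | true  | true  | px with () ← px refl refl
  ... | true  | false | _  = s≤s (countB-disjoint p#q xs)
  ... | false | true  | _  rewrite +-suc (countB p xs) (countB q xs) = s≤s (countB-disjoint p#q xs)
  ... | false | false | _  = m≤n⇒m≤1+n (countB-disjoint p#q xs)

  countB-pos : (p : A → Bool) {x : A} {xs : List A} → x ∈ xs → p x ≡ true → 1 ≤ countB p xs
  countB-pos p {xs = y ∷ xs} x∈xs px with p y in py
  ... | true  = s≤s z≤n
  countB-pos p (here refl) px  | false with () ← trans (sym py) px
  countB-pos p (there x∈xs) px | false = countB-pos p x∈xs px

  countB-∨+countB-∧ : (p q : A → Bool) (xs : List A) →
    countB (λ x → p x ∨ q x) xs + countB (λ x → p x ∧ q x) xs ≡ countB p xs + countB q xs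
  countB-∨+countB-∧ p q [] = refl
  countB-∨+countB-∧ p q (x ∷ xs) with p x | q x
  ... | true  | true
    rewrite +-suc (countB (λ x → p x ∨ q x) xs) (countB (λ x → p x ∧ q x) xs)
          | +-suc (countB p xs) (countB q xs) = cong (suc ∘ suc) (countB-∨+countB-∧ p q xs)
  ... | true  | false = cong suc (countB-∨+countB-∧ p q xs)
  ... | false | true  rewrite +-suc (countB p xs) (countB q xs) = cong suc (countB-∨+countB-∧ p q xs)
  ... | false | false = countB-∨+countB-∧ p q xs

  countB-∧-not+countB : {p q : A → Bool} → (∀ x → q x ≡ true → p x ≡ true) → (xs : List A) →
                        countB (λ x → p x ∧ not (q x)) xs + countB q xs ≡ countB p xs
  countB-∧-not+countB q⇒p [] = refl
  countB-∧-not+countB {p} {q} q⇒p (x ∷ xs) with p x | q x | q⇒p x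
  ... | true  | true  | _
    rewrite +-suc (countB (λ x → p x ∧ not (q x)) xs) (countB q xs) =
      cong suc (countB-∧-not+countB q⇒p xs)
  ... | true  | false | _  = cong suc (countB-∧-not+countB q⇒p xs)
  ... | false | true  | qx with () ← qx refl
  ... | false | false | _  = countB-∧-not+countB q⇒p xs

  countB-≤⇒≡ : {p q : A → Bool} → (∀ x → q x ≡ true → p x ≡ true) → (xs : List A) →
               countB p xs ≤ countB q xs → ∀ {x} → x ∈ xs → p x ≡ q x
  countB-≤⇒≡ {p} {q} q⇒p (y ∷ xs) p≤q y∈ with p y in py | q y in qy | q⇒p y
  ... | true  | false | _ = ⊥-elim (<⇒≱ (s≤s (countB-mono q⇒p xs)) p≤q)
  ... | false | true  | qx with () ← qx refl
  countB-≤⇒≡ q⇒p (y ∷ xs) p≤q (here refl) | true | true | _ = trans py (sym qy)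
  countB-≤⇒≡ q⇒p (y ∷ xs) (s≤s p≤q) (there x∈) | true | true | _ = countB-≤⇒≡ q⇒p xs p≤q x∈
  countB-≤⇒≡ q⇒p (y ∷ xs) p≤q (here refl) | false | false | _ = trans py (sym qy)
  countB-≤⇒≡ q⇒p (y ∷ xs) p≤q (there x∈) | false | false | _ = countB-≤⇒≡ q⇒p xs p≤q x∈

countB-allFin≤n : ∀ {n} (p : Fin n → Bool) → countB p (allFin n) ≤ n
countB-allFin≤n {n} p =
  subst (countB p (allFin n) ≤_) (length-tabulate id) (countB≤length p (allFin n))

countB-allFin-disjoint : ∀ {n} {p q : Fin n → Bool} → (∀ x → p x ≡ true → q x ≢ true) →
                         countB p (allFin n) + countB q (allFin n) ≤ n
countB-allFin-disjoint {n} {p} {q} p#q =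
  subst (countB p (allFin n) + countB q (allFin n) ≤_) (length-tabulate id)
        (countB-disjoint p#q (allFin n))

module _ {n : ℕ} {adj : Fin n → Fin n → Bool} where

  _++ʷ_ : ∀ {u v w p q} → Walk adj u v p → Walk adj v w q → Walk adj u w (p + q)
  nil       ++ʷ w′ = w′
  cons e w  ++ʷ w′ = cons e (w ++ʷ w′)

  splitWalk : ∀ {u v m} → Walk adj u v m → ∀ j → j ≤ m →
              ∃[ w ] (Walk adj u w j × Walk adj w v (m ∸ j))
  splitWalk {u} w          zero    _       = u , nil , w
  splitWalk     (cons e w) (suc j) (s≤s j≤m) with w′ , p , q ← splitWalk w j j≤m = w′ , cons e p , q

  dist-intermediate : ∀ {u} (dist : Fin n → ℕ) → (∀ w → IsDist adj u w (dist w)) →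
                      ∀ v j → j ≤ dist v → ∃[ w ] (dist w ≡ j)
  dist-intermediate dist isDist v j j≤dv
    with w , p , q ← splitWalk (proj₁ (isDist v)) j j≤dv =
    w , ≤-antisym (proj₂ (isDist w) j p) j≤dw
    where
    dv≤dw+[dv∸j] : dist v ≤ dist w + (dist v ∸ j)
    dv≤dw+[dv∸j] = proj₂ (isDist v) _ (proj₁ (isDist w) ++ʷ q)
    j≤dw : j ≤ dist w
    j≤dw = +-cancelʳ-≤ (dist v ∸ j) j (dist w)
             (subst (_≤ dist w + (dist v ∸ j)) (sym (m+[n∸m]≡n j≤dv)) dv≤dw+[dv∸j])

m+n≤o∧o<2n⇒2m≤o : ∀ {m n o} → m + n ≤ o → o < 2 * n → 2 * m ≤ o
m+n≤o∧o<2n⇒2m≤o {m} {n} {o} m+n≤o o<2n = <⇒≤ (+-cancelʳ-< o (2 * m) o 2m+o<o+o)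
  where
  open ≤-Reasoning
  2m+o<o+o : 2 * m + o < o + o
  2m+o<o+o = begin-strict
    2 * m + o        <⟨ +-monoʳ-< (2 * m) o<2n ⟩
    2 * m + 2 * n    ≡⟨ *-distribˡ-+ 2 m n ⟨
    2 * (m + n)      ≤⟨ *-monoʳ-≤ 2 m+n≤o ⟩
    2 * o            ≡⟨ cong (o +_) (+-identityʳ o) ⟩
    o + o            ∎

m+[n∸1]≤n⇒m≤1 : ∀ {m n} → 1 ≤ n → m + (n ∸ 1) ≤ n → m ≤ 1
m+[n∸1]≤n⇒m≤1 {m} {suc n} _ = +-cancelʳ-≤ n m 1

m≤n∸1∧n<2m⇒m≡n∸1 : ∀ {m n} → n ≡ 3 ⊎ n ≡ 4 → m ≤ n ∸ 1 → n < 2 * m → m ≡ n ∸ 1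
m≤n∸1∧n<2m⇒m≡n∸1 {2} (inj₁ refl) _ _ = refl
m≤n∸1∧n<2m⇒m≡n∸1 {3} (inj₂ refl) _ _ = refl
m≤n∸1∧n<2m⇒m≡n∸1 {0} (inj₁ refl) _ ()
m≤n∸1∧n<2m⇒m≡n∸1 {1} (inj₁ refl) _ (s≤s (s≤s ()))
m≤n∸1∧n<2m⇒m≡n∸1 {suc (suc (suc _))} (inj₁ refl) (s≤s (s≤s ())) _
m≤n∸1∧n<2m⇒m≡n∸1 {0} (inj₂ refl) _ ()
m≤n∸1∧n<2m⇒m≡n∸1 {1} (inj₂ refl) _ (s≤s (s≤s ()))
m≤n∸1∧n<2m⇒m≡n∸1 {2} (inj₂ refl) _ (s≤s (s≤s (s≤s (s≤s ()))))
m≤n∸1∧n<2m⇒m≡n∸1 {suc (suc (suc (suc _)))} (inj₂ refl) (s≤s (s≤s (s≤s ()))) _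

module ClumpGraph {k : ℕ} (G : ColLayGraph k) (SC : StronglyCanonical G) where
  open ColLayGraph G
  open StronglyCanonical SC

  InL : ℕ → Fin k → Set
  InL i c = clumpIn G i c ≡ true

  InS : ℕ → Fin k → Set
  InS i c = inS G i c ≡ true

  clumpIn⁻ : ∀ {i c} → InL i c → ∃[ v ] (layer v ≡ i × col v ≡ c)
  clumpIn⁻ h with v , hv ← any-true⁻ _ (allFin n) h with lv , cv ← ∧-true⁻ (layer v ≡ᵇ _) hv =
    v , ≡ᵇ⇒≡ _ _ (Equivalence.from T-≡ lv) , ==ᶠ⇒≡ cv

  inOwnClump : ∀ v → ((layer v ≡ᵇ layer v) ∧ (col v ==ᶠ col v)) ≡ true
  inOwnClump v = ∧-true⁺ (≡ᵇ-refl (layer v)) (==ᶠ-refl (col v))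

  clumpIn⁺ : ∀ v → InL (layer v) (col v)
  clumpIn⁺ v = any-true⁺ _ (∈-allFin v) (inOwnClump v)

  clumpAdj⁻ : ∀ {i c j c′} → clumpAdj G i c j c′ ≡ true →
              ∃[ u ] ∃[ v ] (col u ≡ c × col v ≡ c′ × adj u v ≡ true)
  clumpAdj⁻ {i} {c} {j} {c′} h
    with u , hu ← any-true⁻ _ (allFin n) h
    with v , hv ← any-true⁻ _ (allFin n) hu
    with u∈ic , rest ← ∧-true⁻ ((layer u ≡ᵇ i) ∧ (col u ==ᶠ c)) hv
    with v∈jc′ , e ← ∧-true⁻ ((layer v ≡ᵇ j) ∧ (col v ==ᶠ c′)) rest =
    u , v , ==ᶠ⇒≡ (proj₂ (∧-true⁻ (layer u ≡ᵇ i) u∈ic))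
          , ==ᶠ⇒≡ (proj₂ (∧-true⁻ (layer v ≡ᵇ j) v∈jc′)) , e

  clumpAdj⁺ : ∀ u v → adj u v ≡ true → clumpAdj G (layer u) (col u) (layer v) (col v) ≡ true
  clumpAdj⁺ u v e =
    any-true⁺ _ (∈-allFin u) (any-true⁺ _ (∈-allFin v)
      (∧-true⁺ (inOwnClump u) (∧-true⁺ (inOwnClump v) e)))

  layer≤D : ∀ v → layer v ≤ D
  layer≤D v with d , d≤D , walk , _ ← diam-bound x v = ≤-trans (proj₂ (layer-dist v) d walk) d≤D

  InL⇒≤D : ∀ {i c} → InL i c → i ≤ D
  InL⇒≤D h with v , refl , _ ← clumpIn⁻ h = layer≤D v

  1≤cnt : ∀ {j} → j ≤ D → 1 ≤ cnt G j
  1≤cnt {j} j≤D with v , lv≡D ← ecc-x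
                with w , refl ← dist-intermediate layer layer-dist v j (subst (j ≤_) (sym lv≡D) j≤D) =
    countB-pos _ (∈-allFin (col w)) (clumpIn⁺ w)

  cnt≤k : ∀ i → cnt G i ≤ k
  cnt≤k i = countB-allFin≤n (clumpIn G i)

  ¬clumpAdj-sameColour : ∀ {i j c} → clumpAdj G i c j c ≢ true
  ¬clumpAdj-sameColour h with u , v , refl , cv , e ← clumpAdj⁻ h = proper u v e (sym cv)

  saturated-clumps : ∀ {i j c c′} → InL i c → InL j c′ → c ≢ c′ → suc i ≡ j ⊎ suc j ≡ i →
                     clumpAdj G i c j c′ ≡ true
  saturated-clumps hc hc′ c≢c′ consecutive
    with u , refl , refl ← clumpIn⁻ hc | v , refl , refl ← clumpIn⁻ hc′ =
    clumpAdj⁺ u v (saturated u v c≢c′ (inj₂ consecutive))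

  adjacentIfPresent : ℕ → Fin k → ℕ → Fin k → Bool
  adjacentIfPresent i c j c′ = clumpIn G j c′ ⇒ᵇ clumpAdj G i c j c′

  adjacentToLayer : ℕ → Fin k → ℕ → Bool
  adjacentToLayer i c j = all (adjacentIfPresent i c j) (allFin k)

  adjacentToLayer-true⁻ : ∀ {i j c c′} → adjacentToLayer i c j ≡ true → InL j c′ →
                          clumpAdj G i c j c′ ≡ true
  adjacentToLayer-true⁻ {i} {j} {c} h =
    ⇒ᵇ-true⁻ (all-true⁻ (adjacentIfPresent i c j) h (∈-allFin _))

  adjacentToLayer-true⁺ : ∀ {i j c} → InL i c → ¬ InL j c → suc i ≡ j ⊎ suc j ≡ i →
                          adjacentToLayer i c j ≡ true
  adjacentToLayer-true⁺ {i} {j} {c} hc c∉j consecutive =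
    all-true⁺ (adjacentIfPresent i c j) {allFin k} λ c′ →
      ⇒ᵇ-true⁺ λ hc′ → saturated-clumps hc hc′ (λ { refl → c∉j hc′ }) consecutive

  InS⇒InL : ∀ {i c} → InS i c → InL i c
  InS⇒InL {i} {c} h = proj₁ (∧-true⁻ (clumpIn G i c) h)

  InS⇒adjacent-next : ∀ {i c} → InS i c → adjacentToLayer i c (suc i) ≡ true
  InS⇒adjacent-next {i} {c} h =
    proj₁ (∧-true⁻ (adjacentToLayer i c (suc i)) (proj₂ (∧-true⁻ (clumpIn G i c) h)))

  InS⇒adjacent-prev : ∀ {j c} → InS (suc j) c → adjacentToLayer (suc j) c j ≡ true
  InS⇒adjacent-prev {j} {c} h =
    proj₂ (∧-true⁻ (adjacentToLayer (suc j) c (suc (suc j)))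
                   (proj₂ (∧-true⁻ (clumpIn G (suc j) c) h)))

  InS⇒∉next : ∀ {i c} → InS i c → ¬ InL (suc i) c
  InS⇒∉next h hc = ¬clumpAdj-sameColour (adjacentToLayer-true⁻ (InS⇒adjacent-next h) hc)

  InS⇒∉prev : ∀ {j c} → InS (suc j) c → ¬ InL j c
  InS⇒∉prev h hc = ¬clumpAdj-sameColour (adjacentToLayer-true⁻ (InS⇒adjacent-prev h) hc)

  isolated⇒InS : ∀ {i c} → InL i c → ¬ InL (suc i) c → (∀ {j} → suc j ≡ i → ¬ InL j c) → InS i c
  isolated⇒InS {zero} hc c∉next _ =
    ∧-true⁺ hc (∧-true⁺ (adjacentToLayer-true⁺ hc c∉next (inj₁ refl)) refl)
  isolated⇒InS {suc j} hc c∉next c∉prev =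
    ∧-true⁺ hc (∧-true⁺ (adjacentToLayer-true⁺ hc c∉next (inj₁ refl))
                        (adjacentToLayer-true⁺ hc (c∉prev refl) (inj₂ refl)))

  sizeS≤cnt : ∀ i → sizeS G i ≤ cnt G i
  sizeS≤cnt i = countB-mono (λ _ → InS⇒InL) (allFin k)

  sizeLminusS+sizeS≡cnt : ∀ i → sizeLminusS G i + sizeS G i ≡ cnt G i
  sizeLminusS+sizeS≡cnt i = countB-∧-not+countB (λ _ → InS⇒InL) (allFin k)

  cnt+sizeS-suc≤k : ∀ i → cnt G i + sizeS G (suc i) ≤ k
  cnt+sizeS-suc≤k i = countB-allFin-disjoint λ _ hc hs → InS⇒∉prev hs hc

  cnt-suc+sizeS≤k : ∀ i → cnt G (suc i) + sizeS G i ≤ k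
  cnt-suc+sizeS≤k i = countB-allFin-disjoint λ _ hc hs → InS⇒∉next hs hc

  cnt+sizeSPrev≤k : ∀ i → cnt G i + sizeSPrev G i ≤ k
  cnt+sizeSPrev≤k zero    = subst (_≤ k) (sym (+-identityʳ _)) (cnt≤k 0)
  cnt+sizeSPrev≤k (suc i) = cnt-suc+sizeS≤k i

  sizeS+sizeS-suc≤k : ∀ i → sizeS G i + sizeS G (suc i) ≤ k
  sizeS+sizeS-suc≤k i = ≤-trans (+-monoˡ-≤ _ (sizeS≤cnt i)) (cnt+sizeS-suc≤k i)

  disjoint-if-cnt+cnt≤k : ∀ {i c} → cnt G i + cnt G (suc i) ≤ k → InL i c → ¬ InL (suc i) c
  disjoint-if-cnt+cnt≤k {i} {c} sum≤k hc hc′ = <-irrefl refl (begin-strict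
      cnt2 G i                 <⟨ m<m+n (cnt2 G i) common-pos ⟩
      cnt2 G i + common        ≡⟨ countB-∨+countB-∧ (clumpIn G i) (clumpIn G (suc i)) (allFin k) ⟩
      cnt G i + cnt G (suc i)  ≡⟨ union≡sum ⟨
      cnt2 G i                 ∎)
    where
    open ≤-Reasoning
    common : ℕ
    common = countB (λ c → clumpIn G i c ∧ clumpIn G (suc i) c) (allFin k)
    common-pos : 1 ≤ common
    common-pos = countB-pos _ (∈-allFin c) (∧-true⁺ hc hc′)
    union≡sum : cnt2 G i ≡ cnt G i + cnt G (suc i)
    union≡sum = trans (CanonicalAt.condB (canonical i (InL⇒≤D hc′))) (m≥n⇒m⊓n≡n sum≤k)

  full⇒cnt-suc≢1 : ∀ {i} → i < D → cnt G i ≡ k → cnt G (suc i) ≢ 1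
  full⇒cnt-suc≢1 i<D full cnt≡1 =
    ≤⇒≯ (≤-reflexive cnt≡1) (proj₂ (CanonicalAt.condC (canonical _ i<D) full))

  singleton⇒∉next : ∀ {i c} → cnt G i ≡ 1 → InL i c → ¬ InL (suc i) c
  singleton⇒∉next {i} cnt≡1 hc hc′ = disjoint-if-cnt+cnt≤k sum≤k hc hc′
    where
    open ≤-Reasoning
    sum≤k : cnt G i + cnt G (suc i) ≤ k
    sum≤k = begin
      cnt G i + cnt G (suc i)  ≡⟨ cong (_+ cnt G (suc i)) cnt≡1 ⟩
      1 + cnt G (suc i)        ≤⟨ +-monoʳ-≤ 1 (CanonicalAt.condA (canonical i (InL⇒≤D hc′)) cnt≡1) ⟩
      1 + (k ∸ 1)              ≡⟨ m+[n∸m]≡n (subst (_≤ k) cnt≡1 (cnt≤k i)) ⟩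
      k                        ∎

  singleton⇒∉prev : ∀ {j c} → cnt G (suc j) ≡ 1 → InL (suc j) c → ¬ InL j c
  singleton⇒∉prev {j} cnt≡1 hc hc′ with cnt G j + cnt G (suc j) ≤? k
  ... | yes sum≤k = disjoint-if-cnt+cnt≤k sum≤k hc′ hc
  ... | no  sum≰k = full⇒cnt-suc≢1 (InL⇒≤D hc) full cnt≡1
    where
    k<cnt+1 : k < cnt G j + 1
    k<cnt+1 = subst (λ m → k < cnt G j + m) cnt≡1 (≰⇒> sum≰k)
    full : cnt G j ≡ k
    full = ≤-antisym (cnt≤k j) (m<1+n⇒m≤n (subst (k <_) (+-comm (cnt G j) 1) k<cnt+1))

  singleton⇒InS : ∀ {i c} → cnt G i ≡ 1 → InL i c → InS i c
  singleton⇒InS {zero}  cnt≡1 hc = isolated⇒InS hc (singleton⇒∉next cnt≡1 hc) λ ()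
  singleton⇒InS {suc j} cnt≡1 hc =
    isolated⇒InS hc (singleton⇒∉next cnt≡1 hc) λ { refl → singleton⇒∉prev cnt≡1 hc }

  singleton⇒LeqS : ∀ {i} → cnt G i ≡ 1 → LeqS G i
  singleton⇒LeqS cnt≡1 c = true⇔true⇒≡ (singleton⇒InS cnt≡1) InS⇒InL

  singleton⇒sizeS≡1 : ∀ {i} → cnt G i ≡ 1 → sizeS G i ≡ 1
  singleton⇒sizeS≡1 {i} cnt≡1 = trans (≤-antisym (sizeS≤cnt i) cnt≤sizeS) cnt≡1
    where
    cnt≤sizeS : cnt G i ≤ sizeS G i
    cnt≤sizeS = countB-mono (λ c hc → trans (sym (singleton⇒LeqS cnt≡1 c)) hc) (allFin k)

  singleton⇒¬Big : 2 ≤ k → ∀ {i} → cnt G i ≡ 1 → ¬ Big G i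
  singleton⇒¬Big 2≤k cnt≡1 big = <⇒≱ (subst (λ s → k < 2 * s) (singleton⇒sizeS≡1 cnt≡1) big) 2≤k

  cnt+⊔sizeS≤k : ∀ i → cnt G i + (sizeSPrev G i ⊔ sizeS G (suc i)) ≤ k
  cnt+⊔sizeS≤k i =
    subst (_≤ k) (sym (+-distribˡ-⊔ (cnt G i) _ _)) (⊔-lub (cnt+sizeSPrev≤k i) (cnt+sizeS-suc≤k i))

  sizeS≤k∸1 : 2 ≤ k → ∀ {i} → i ≤ D → sizeS G i ≤ k ∸ 1
  sizeS≤k∸1 2≤k {i} i≤D with m≤n⇒m<n∨m≡n i≤D
  ... | inj₁ i<D = ∸-monoˡ-≤ 1 (≤-trans (+-monoˡ-≤ (sizeS G i) (1≤cnt i<D)) (cnt-suc+sizeS≤k i))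
  ... | inj₂ refl = subst (_≤ k ∸ 1) (sym (singleton⇒sizeS≡1 cD)) (∸-monoˡ-≤ 1 2≤k)

  big⇒1≤i : 2 ≤ k → ∀ {i} → Big G i → 1 ≤ i
  big⇒1≤i 2≤k {zero}  big = ⊥-elim (singleton⇒¬Big 2≤k c0 big)
  big⇒1≤i 2≤k {suc i} _   = s≤s z≤n

  big⇒i≤D∸1 : 2 ≤ k → ∀ {i} → i ≤ D → Big G i → i ≤ D ∸ 1
  big⇒i≤D∸1 2≤k i≤D big with m≤n⇒m<n∨m≡n i≤D
  ... | inj₁ i<D  = ∸-monoˡ-≤ 1 i<D
  ... | inj₂ refl = ⊥-elim (singleton⇒¬Big 2≤k cD big)

  big⇒SmallPrev : ∀ {i} → Big G i → SmallPrev G i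
  big⇒SmallPrev {zero}  _   = z≤n
  big⇒SmallPrev {suc i} big = m+n≤o∧o<2n⇒2m≤o {sizeS G i} (sizeS+sizeS-suc≤k i) big

  big⇒SmallNext : ∀ {i} → Big G i → Small G (suc i)
  big⇒SmallNext {i} big =
    m+n≤o∧o<2n⇒2m≤o {sizeS G (suc i)} (subst (_≤ k) (+-comm (sizeS G i) _) (sizeS+sizeS-suc≤k i)) big

  ⊔sizeLminusS+sizeS+sizeS≤k :
    ∀ i → (sizeLminusS G i ⊔ sizeLminusS G (suc i)) + sizeS G i + sizeS G (suc i) ≤ k
  ⊔sizeLminusS+sizeS+sizeS≤k i =
    subst (_≤ k) (sym (trans (cong (_+ t) (+-distribʳ-⊔ s a b)) (+-distribʳ-⊔ t (a + s) (b + s))))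
      (⊔-lub a+s+t≤k b+s+t≤k)
    where
    open ≤-Reasoning
    a = sizeLminusS G i
    b = sizeLminusS G (suc i)
    s = sizeS G i
    t = sizeS G (suc i)
    a+s+t≤k : a + s + t ≤ k
    a+s+t≤k = subst (λ m → m + t ≤ k) (sym (sizeLminusS+sizeS≡cnt i)) (cnt+sizeS-suc≤k i)
    b+s+t≤k : b + s + t ≤ k
    b+s+t≤k = begin
      b + s + t          ≡⟨ +-assoc b s t ⟩
      b + (s + t)        ≡⟨ cong (b +_) (+-comm s t) ⟩
      b + (t + s)        ≡⟨ +-assoc b t s ⟨
      b + t + s          ≡⟨ cong (_+ s) (sizeLminusS+sizeS≡cnt (suc i)) ⟩
      cnt G (suc i) + s  ≤⟨ cnt-suc+sizeS≤k i ⟩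
      k                  ∎

  singleton⇒sizeS<k∸1 : 3 ≤ k → ∀ {i} → cnt G i ≡ 1 → sizeS G i < k ∸ 1
  singleton⇒sizeS<k∸1 3≤k cnt≡1 = subst (_< k ∸ 1) (sym (singleton⇒sizeS≡1 cnt≡1)) (∸-monoˡ-≤ 1 3≤k)

  cnt+[k∸1]≤k⇒singleton : ∀ {i} → i ≤ D → cnt G i + (k ∸ 1) ≤ k → cnt G i ≡ 1
  cnt+[k∸1]≤k⇒singleton {i} i≤D h =
    ≤-antisym (m+[n∸1]≤n⇒m≤1 (≤-trans (1≤cnt i≤D) (cnt≤k i)) h) (1≤cnt i≤D)

  sizeS≡k∸1⇒neighbours-singletons : 3 ≤ k → ∀ {i} → i ≤ D → sizeS G i ≡ k ∸ 1 →
    LeqS G i × cntPrev G i ≡ 1 × sizeSPrev G i ≡ 1 × cnt G (suc i) ≡ 1 × sizeS G (suc i) ≡ 1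
  sizeS≡k∸1⇒neighbours-singletons 3≤k {zero} _ s≡k∸1 =
    ⊥-elim (<⇒≢ (singleton⇒sizeS<k∸1 3≤k c0) s≡k∸1)
  sizeS≡k∸1⇒neighbours-singletons 3≤k {suc j} i≤D s≡k∸1 with m≤n⇒m<n∨m≡n i≤D
  ... | inj₂ refl = ⊥-elim (<⇒≢ (singleton⇒sizeS<k∸1 3≤k cD) s≡k∸1)
  ... | inj₁ i<D  =
    L≡S , cnt-prev≡1 , singleton⇒sizeS≡1 cnt-prev≡1 , cnt-next≡1 , singleton⇒sizeS≡1 cnt-next≡1
    where
    cnt-next≡1 : cnt G (suc (suc j)) ≡ 1
    cnt-next≡1 = cnt+[k∸1]≤k⇒singleton i<D
                   (subst (λ s → cnt G (suc (suc j)) + s ≤ k) s≡k∸1 (cnt-suc+sizeS≤k (suc j)))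
    cnt-prev≡1 : cnt G j ≡ 1
    cnt-prev≡1 = cnt+[k∸1]≤k⇒singleton (<⇒≤ i≤D)
                   (subst (λ s → cnt G j + s ≤ k) s≡k∸1 (cnt+sizeS-suc≤k j))
    cnt<k : cnt G (suc j) < k
    cnt<k = ≤∧≢⇒< (cnt≤k (suc j)) λ full → full⇒cnt-suc≢1 i<D full cnt-next≡1
    cnt≤sizeS : cnt G (suc j) ≤ sizeS G (suc j)
    cnt≤sizeS = subst (cnt G (suc j) ≤_) (sym s≡k∸1) (∸-monoˡ-≤ 1 cnt<k)
    L≡S : LeqS G (suc j)
    L≡S c = countB-≤⇒≡ (λ _ → InS⇒InL) (allFin k) cnt≤sizeS (∈-allFin c)

lemma4p3 : (k : ℕ) → 3 ≤ k → (G : ColLayGraph k) → StronglyCanonical G →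
    (i : ℕ) → i ≤ ColLayGraph.D G →
      (cnt G i + (sizeSPrev G i ⊔ sizeS G (suc i)) ≤ k)
      × (sizeS G i ≤ k ∸ 1)
      × (Big G i → (1 ≤ i × i ≤ ColLayGraph.D G ∸ 1 × SmallPrev G i × Small G (suc i)))
      × (cnt G i ≡ 1 → LeqS G i)
      × ((sizeLminusS G i ⊔ sizeLminusS G (suc i)) + sizeS G i + sizeS G (suc i) ≤ k)
      × (sizeS G i ≡ k ∸ 1 →
           (LeqS G i × cntPrev G i ≡ 1 × sizeSPrev G i ≡ 1
             × cnt G (suc i) ≡ 1 × sizeS G (suc i) ≡ 1))
      × ((k ≡ 3 ⊎ k ≡ 4) → Big G i → sizeS G i ≡ k ∸ 1)
lemma4p3 k 3≤k G SC i i≤D =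
    cnt+⊔sizeS≤k i
  , sizeS≤k∸1 2≤k i≤D
  , (λ big → big⇒1≤i 2≤k big , big⇒i≤D∸1 2≤k i≤D big , big⇒SmallPrev big , big⇒SmallNext big)
  , singleton⇒LeqS
  , ⊔sizeLminusS+sizeS+sizeS≤k i
  , sizeS≡k∸1⇒neighbours-singletons 3≤k i≤D
  , (λ k≡3⊎k≡4 big → m≤n∸1∧n<2m⇒m≡n∸1 k≡3⊎k≡4 (sizeS≤k∸1 2≤k i≤D) big)
  where
  open ClumpGraph G SC
  2≤k : 2 ≤ k
  2≤k = <⇒≤ 3≤k
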